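{- For every type $\tau$ and all closed terms $t,s$ of type $\tau$: if $\mathcal{M}^{\omega}_{\tau}(t,s)$ then $t\lesssim^{\mathsf{bool}}_\tau s$, where $t\lesssim^{\mathsf{bool}}_\tau s$ means that for every context $C$ of type $\mathsf{bool}$ with a hole of type $\tau$, if $C[t]{\Downarrow}$ then $C[s]{\Downarrow}$.
   Context: Types of $\mu$TCL: closed type expressions, modulo $\alpha$-equivalence, of the grammar $\tau::=\alpha\mid \tau_1\boxplus\tau_2\mid\tau_1\boxtimes\tau_2\mid \tau_1\Rightarrow\tau_2\mid \mu\alpha.\tau$; $\mathsf{void}=\mu\alpha.\alpha$, $\mathsf{unit}=\mathsf{void}\Rightarrow\mathsf{void}$, $\mathsf{bool}=\mathsf{unit}\boxplus\mathsf{unit}$. Closed terms are built from: constants $S_{\tau_1,\tau_2,\tau_3}\colon(\tau_1\Rightarrow\tau_2\Rightarrow\tau_3)\Rightarrow(\tau_1\Rightarrow\tau_2)\Rightarrow\tau_1\Rightarrow\tau_3$, $K_{\tau_1,\tau_2}\colon \tau_1\Rightarrow\tau_2\Rightarrow\tau_1$, $I_\tau\colon\tau\Rightarrow\tau$; operations $S'\colon(\tau_1\Rightarrow\tau_2\Rightarrow\tau_3)\to((\tau_1\Rightarrow\tau_2)\Rightarrow\tau_1\Rightarrow\tau_3)$, $S''\colon (\tau_1\Rightarrow\tau_2\Rightarrow\tau_3)\times(\tau_1\Rightarrow\tau_2)\to(\tau_1\Rightarrow\tau_3)$, $K'\colon\tau_1\to(\tau_2\Rightarrow\tau_1)$, application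 $t\,s$ of type $\tau_2$ for $t\colon\tau_1\Rightarrow\tau_2$, $s\colon\tau_1$, $\mathsf{inl}\colon\tau_1\to\tau_1\boxplus\tau_2$, $\mathsf{inr}\colon\tau_2\to\tau_1\boxplus\tau_2$, $\mathsf{case}\colon(\tau_1\boxplus\tau_2)\times(\tau_1\Rightarrow\tau_3)\times(\tau_2\Rightarrow\tau_3)\to\tau_3$, $\mathsf{pair}\colon\tau_1\times\tau_2\to\tau_1\boxtimes\tau_2$, $\mathsf{fst}\colon\tau_1\boxtimes\tau_2\to\tau_1$, $\mathsf{snd}\colon\tau_1\boxtimes\tau_2\to\tau_2$, $\mathsf{fold}_\tau\colon\tau[\mu\alpha.\tau/\alpha]\to\mu\alpha.\tau$, $\mathsf{unfold}_\tau\colon\mu\alpha.\tau\to\tau[\mu\alpha.\tau/\alpha]$. A context $C$ of type $\tau'$ with hole of type $\tau$ is a term of type $\tau'$ with at most one occurrence of a variable $\cdot$ of type $\tau$; $C[t]$ substitutes $t$ for it. Transitions are exactly those derivable by: $S\xrightarrow{e}S'(e)$; $S'(t)\xrightarrow{e}S''(t,e)$; $S''(t,s)\xrightarrow{e}(t\,e)(s\,e)$; $K\xrightarrow{e}K'(e)$; $K'(t)\xrightarrow{e}t$; $I\xrightarrow{e}e$; $t\to t'\Rightarrow t\,s\to t'\,s$; $t\xrightarrow{s}t'\Rightarrow t\,s\to t'$; $\mathsf{inl}(t)\xrightarrow{\boxplus_1}t$; $\mathsf{inr}(t)\xrightarrow{\boxplus_2}t$; $t\to t'\Rightarrow\mathsf{case}(t,s,r)\to\mathsf{case}(t',s,r)$;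 $t\xrightarrow{\boxplus_1}t'\Rightarrow\mathsf{case}(t,s,r)\to s\,t'$; $t\xrightarrow{\boxplus_2}t'\Rightarrow\mathsf{case}(t,s,r)\to r\,t'$; $\mathsf{pair}(t,s)\xrightarrow{\boxtimes_1}t$; $\mathsf{pair}(t,s)\xrightarrow{\boxtimes_2}s$; $t\to t'\Rightarrow\mathsf{fst}(t)\to\mathsf{fst}(t'),\ \mathsf{snd}(t)\to\mathsf{snd}(t')$; $t\xrightarrow{\boxtimes_1}t'\Rightarrow\mathsf{fst}(t)\to t'$; $t\xrightarrow{\boxtimes_2}t'\Rightarrow\mathsf{snd}(t)\to t'$; $\mathsf{fold}(t)\xrightarrow{\mu}t$; $t\to t'\Rightarrow\mathsf{unfold}(t)\to\mathsf{unfold}(t')$; $t\xrightarrow{\mu}t'\Rightarrow\mathsf{unfold}(t)\to t'$. $\Rightarrow$ is the reflexive transitive closure of $\to$; $t\overset{l}{\Rightarrow}s$ iff $t\Rightarrow t'\xrightarrow{l}s$ for some $t'$; $t{\Downarrow}$ iff $t\overset{l}{\Rightarrow}s$ for some label $l$ and some $s$. Extended weak transitions: for $t,s$ of function type $\tau_1\Rightarrow\tau_2$ and $e$ of type $\tau_1$, $t\overset{e}{\Rrightarrow}s$ iff there is $t'$ with $t\Rightarrow t'$ and ($t'\xrightarrow{e}s$ or $s=t'\,e$); for other labels $t\overset{l}{\Rrightarrow}s$ iff $t\overset{l}{\Rightarrow}s$. For type-indexed relations $Q,R$: $\mathcal{E}(R)_\tau=\{(t,s)\mid t\to t'\implies\exists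 s'.\,s\Rightarrow s'\wedge R_\tau(t',s')\}$; $\mathcal{V}'_{\tau_1\boxplus\tau_2}(Q,R)=\{(t,s)\mid$ for $i=1,2$: $t\xrightarrow{\boxplus_i}t'\implies\exists s'.\,s\overset{\boxplus_i}{\Rrightarrow}s'\wedge R_{\tau_i}(t',s')\}$; $\mathcal{V}'_{\tau_1\boxtimes\tau_2}(Q,R)=\{(t,s)\mid t\xrightarrow{\boxtimes_1}t_1\wedge t\xrightarrow{\boxtimes_2}t_2\implies \exists s_1,s_2.\,s\overset{\boxtimes_1}{\Rrightarrow}s_1\wedge s\overset{\boxtimes_2}{\Rrightarrow}s_2\wedge R_{\tau_1}(t_1,s_1)\wedge R_{\tau_2}(t_2,s_2)\}$; $\mathcal{V}'_{\tau_1\Rightarrow\tau_2}(Q,R)=\{(t,s)\mid\forall e_1,e_2.\,Q_{\tau_1}(e_1,e_2)\wedge t\xrightarrow{e_1}t'\implies\exists s'.\,s\overset{e_2}{\Rrightarrow}s'\wedge R_{\tau_2}(t',s')\}$; $\mathcal{V}'_{\mu\alpha.\tau}(Q,R)=\{(t,s)\mid t\xrightarrow{\mu}t'\implies\exists s'.\,s\overset{\mu}{\Rrightarrow}s'\wedge R_{\tau[\mu\alpha.\tau/\alpha]}(t',s')\}$. $\mathcal{M}^0$ is the full relation, $\mathcal{M}^{n+1}=\mathcal{M}^n\cap\mathcal{E}(\mathcal{M}^n)\cap\mathcal{V}'(\mathcal{M}^n,\mathcal{M}^n)$, $\mathcal{M}^\omega=\bigcap_{n<\omega}\mathcal{M}^n$.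 -}

module Defs where

open import Data.Nat using (ℕ; zero; suc; _+_; _≤_)
open import Data.Fin using (Fin; zero; suc)
open import Data.Maybe using (Maybe; just; nothing)
open import Data.Product using (Σ; ∃; _×_; _,_)
open import Data.Sum using (_⊎_)
open import Data.Unit using (⊤)
open import Relation.Binary.PropositionalEquality using (_≡_)
open import Relation.Binary.Construct.Closure.ReflexiveTransitive using (Star)

-- Types of μTCL, in de Bruijn form (so α-equivalence is syntactic
-- equality).  Ty n = type expressions with n free type variables;
-- closed types are Ty 0.

infixr 7 _⇒_
infixr 6 _⊠_
infixr 5 _⊞_

data Ty (n : ℕ) : Set where
  var : Fin n → Ty n
  _⊞_ : Ty n → Ty n → Ty n
  _⊠_ : Ty n → Ty n → Ty n
  _⇒_ : Ty n → Ty n → Ty n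
  μ   : Ty (suc n) → Ty n

rename : ∀ {m n} → (Fin m → Fin n) → Ty m → Ty n
rename ρ (var i)   = var (ρ i)
rename ρ (a ⊞ b)   = rename ρ a ⊞ rename ρ b
rename ρ (a ⊠ b)   = rename ρ a ⊠ rename ρ b
rename ρ (a ⇒ b)   = rename ρ a ⇒ rename ρ b
rename ρ (μ a)     = μ (rename ext a)
  where
  ext : Fin (suc _) → Fin (suc _)
  ext zero    = zero
  ext (suc i) = suc (ρ i)

exts : ∀ {m n} → (Fin m → Ty n) → Fin (suc m) → Ty (suc n)
exts σ zero    = var zero
exts σ (suc i) = rename suc (σ i)

subst : ∀ {m n} → (Fin m → Ty n) → Ty m → Ty n
subst σ (var i) = σ i
subst σ (a ⊞ b) = subst σ a ⊞ subst σ b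
subst σ (a ⊠ b) = subst σ a ⊠ subst σ b
subst σ (a ⇒ b) = subst σ a ⇒ subst σ b
subst σ (μ a)   = μ (subst (exts σ) a)

sub0 : Ty 0 → Fin 1 → Ty 0
sub0 u zero = u

_[_] : Ty 1 → Ty 0 → Ty 0
τ [ u ] = subst (sub0 u) τ

unroll : Ty 1 → Ty 0
unroll τ = τ [ μ τ ]

Type : Set
Type = Ty 0

void unit bool : Type
void = μ (var zero)
unit = void ⇒ void
bool = unit ⊞ unit

-- Terms.  Term nothing τ  = closed terms of type τ.
-- Term (just h) τ = terms of type τ possibly containing the hole
-- variable · (constructor `hole`) of type h.

data Term (Γ : Maybe Type) : Type → Set where
  hole   : ∀ {h} → Γ ≡ just h → Term Γ h
  S      : ∀ {a b c} → Term Γ ((a ⇒ b ⇒ c) ⇒ (a ⇒ b) ⇒ a ⇒ c)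
  K      : ∀ {a b} → Term Γ (a ⇒ b ⇒ a)
  I      : ∀ {a} → Term Γ (a ⇒ a)
  S′     : ∀ {a b c} → Term Γ (a ⇒ b ⇒ c) → Term Γ ((a ⇒ b) ⇒ a ⇒ c)
  S″     : ∀ {a b c} → Term Γ (a ⇒ b ⇒ c) → Term Γ (a ⇒ b) → Term Γ (a ⇒ c)
  K′     : ∀ {a b} → Term Γ a → Term Γ (b ⇒ a)
  app    : ∀ {a b} → Term Γ (a ⇒ b) → Term Γ a → Term Γ b
  inl    : ∀ {a b} → Term Γ a → Term Γ (a ⊞ b)
  inr    : ∀ {a b} → Term Γ b → Term Γ (a ⊞ b)
  case   : ∀ {a b c} → Term Γ (a ⊞ b) → Term Γ (a ⇒ c) → Term Γ (b ⇒ c) → Term Γ c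
  pair   : ∀ {a b} → Term Γ a → Term Γ b → Term Γ (a ⊠ b)
  fst    : ∀ {a b} → Term Γ (a ⊠ b) → Term Γ a
  snd    : ∀ {a b} → Term Γ (a ⊠ b) → Term Γ b
  fold   : ∀ {τ} → Term Γ (unroll τ) → Term Γ (μ τ)
  unfold : ∀ {τ} → Term Γ (μ τ) → Term Γ (unroll τ)

Tm : Type → Set
Tm = Term nothing

occ : ∀ {Γ τ} → Term Γ τ → ℕ
occ (hole _)     = 1
occ S            = 0
occ K            = 0
occ I            = 0
occ (S′ t)       = occ t
occ (S″ t s)     = occ t + occ s
occ (K′ t)       = occ t
occ (app t s)    = occ t + occ s
occ (inl t)      = occ t
occ (inr t)      = occ t
occ (case t s r) = occ t + occ s + occ r
occ (pair t s)   = occ t + occ s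
occ (fst t)      = occ t
occ (snd t)      = occ t
occ (fold t)     = occ t
occ (unfold t)   = occ t

record Context (τ τ′ : Type) : Set where
  constructor ctx
  field
    term   : Term (just τ) τ′
    linear : occ term ≤ 1

plugT : ∀ {h τ} → Term (just h) τ → Tm h → Tm τ
plugT (hole _≡_.refl) u = u
plugT S            u = S
plugT K            u = K
plugT I            u = I
plugT (S′ t)       u = S′ (plugT t u)
plugT (S″ t s)     u = S″ (plugT t u) (plugT s u)
plugT (K′ t)       u = K′ (plugT t u)
plugT (app t s)    u = app (plugT t u) (plugT s u)
plugT (inl t)      u = inl (plugT t u)
plugT (inr t)      u = inr (plugT t u)
plugT (case t s r) u = case (plugT t u) (plugT s u) (plugT r u)
plugT (pair t s)   u = pair (plugT t u) (plugT s u)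
plugT (fst t)      u = fst (plugT t u)
plugT (snd t)      u = snd (plugT t u)
plugT (fold t)     u = fold (plugT t u)
plugT (unfold t)   u = unfold (plugT t u)

_[[_]] : ∀ {τ τ′} → Context τ τ′ → Tm τ → Tm τ′
C [[ t ]] = plugT (Context.term C) t

data Lab : Type → Type → Set where
  arg : ∀ {a b} → Tm a → Lab (a ⇒ b) b
  ⊞₁  : ∀ {a b} → Lab (a ⊞ b) a
  ⊞₂  : ∀ {a b} → Lab (a ⊞ b) b
  ⊠₁  : ∀ {a b} → Lab (a ⊠ b) a
  ⊠₂  : ∀ {a b} → Lab (a ⊠ b) b
  μL  : ∀ {τ} → Lab (μ τ) (unroll τ)

infix 4 _—[_]→_ _⟶_ _⟹_ _⟹[_]_ _⇛[_]_

data _—[_]→_ : ∀ {τ σ} → Tm τ → Lab τ σ → Tm σ → Set where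
  S-e   : ∀ {a b c} {e : Tm (a ⇒ b ⇒ c)} → S {a = a} {b} {c} —[ arg e ]→ S′ e
  S′-e  : ∀ {a b c} {t : Tm (a ⇒ b ⇒ c)} {e : Tm (a ⇒ b)} → S′ t —[ arg e ]→ S″ t e
  S″-e  : ∀ {a b c} {t : Tm (a ⇒ b ⇒ c)} {s : Tm (a ⇒ b)} {e : Tm a} →
          S″ t s —[ arg e ]→ app (app t e) (app s e)
  K-e   : ∀ {a b} {e : Tm a} → K {b = b} —[ arg e ]→ K′ e
  K′-e  : ∀ {a b} {t : Tm a} {e : Tm b} → K′ t —[ arg e ]→ t
  I-e   : ∀ {a} {e : Tm a} → I —[ arg e ]→ e
  inl-l : ∀ {a b} {t : Tm a} → inl {b = b} t —[ ⊞₁ ]→ t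
  inr-l : ∀ {a b} {t : Tm b} → inr {a = a} t —[ ⊞₂ ]→ t
  pair₁ : ∀ {a b} {t : Tm a} {s : Tm b} → pair t s —[ ⊠₁ ]→ t
  pair₂ : ∀ {a b} {t : Tm a} {s : Tm b} → pair t s —[ ⊠₂ ]→ s
  fold-l : ∀ {τ} {t : Tm (unroll τ)} → fold {τ = τ} t —[ μL ]→ t

data _⟶_ : ∀ {τ} → Tm τ → Tm τ → Set where
  app-l   : ∀ {a b} {t t′ : Tm (a ⇒ b)} {s : Tm a} → t ⟶ t′ → app t s ⟶ app t′ s
  app-β   : ∀ {a b} {t : Tm (a ⇒ b)} {s : Tm a} {t′ : Tm b} →
            t —[ arg s ]→ t′ → app t s ⟶ t′
  case-l  : ∀ {a b c} {t t′ : Tm (a ⊞ b)} {s : Tm (a ⇒ c)} {r : Tm (b ⇒ c)} →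
            t ⟶ t′ → case t s r ⟶ case t′ s r
  case-β₁ : ∀ {a b c} {t : Tm (a ⊞ b)} {t′ : Tm a} {s : Tm (a ⇒ c)} {r : Tm (b ⇒ c)} →
            t —[ ⊞₁ ]→ t′ → case t s r ⟶ app s t′
  case-β₂ : ∀ {a b c} {t : Tm (a ⊞ b)} {t′ : Tm b} {s : Tm (a ⇒ c)} {r : Tm (b ⇒ c)} →
            t —[ ⊞₂ ]→ t′ → case t s r ⟶ app r t′
  fst-l   : ∀ {a b} {t t′ : Tm (a ⊠ b)} → t ⟶ t′ → fst t ⟶ fst t′
  snd-l   : ∀ {a b} {t t′ : Tm (a ⊠ b)} → t ⟶ t′ → snd t ⟶ snd t′
  fst-β   : ∀ {a b} {t : Tm (a ⊠ b)} {t′ : Tm a} → t —[ ⊠₁ ]→ t′ → fst t ⟶ t′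
  snd-β   : ∀ {a b} {t : Tm (a ⊠ b)} {t′ : Tm b} → t —[ ⊠₂ ]→ t′ → snd t ⟶ t′
  unfold-l : ∀ {τ} {t t′ : Tm (μ τ)} → t ⟶ t′ → unfold t ⟶ unfold t′
  unfold-β : ∀ {τ} {t : Tm (μ τ)} {t′ : Tm (unroll τ)} →
             t —[ μL ]→ t′ → unfold t ⟶ t′

_⟹_ : ∀ {τ} → Tm τ → Tm τ → Set
_⟹_ = Star _⟶_

_⟹[_]_ : ∀ {τ σ} → Tm τ → Lab τ σ → Tm σ → Set
t ⟹[ l ] s = ∃ λ t′ → t ⟹ t′ × t′ —[ l ]→ s

_⇓ : ∀ {τ} → Tm τ → Set
_⇓ {τ} t = Σ Type λ σ → Σ (Lab τ σ) λ l → ∃ λ s → t ⟹[ l ] s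

_⇛[_]_ : ∀ {τ σ} → Tm τ → Lab τ σ → Tm σ → Set
t ⇛[ arg e ] s = ∃ λ t′ → t ⟹ t′ × (t′ —[ arg e ]→ s ⊎ s ≡ app t′ e)
t ⇛[ ⊞₁ ] s = t ⟹[ ⊞₁ ] s
t ⇛[ ⊞₂ ] s = t ⟹[ ⊞₂ ] s
t ⇛[ ⊠₁ ] s = t ⟹[ ⊠₁ ] s
t ⇛[ ⊠₂ ] s = t ⟹[ ⊠₂ ] s
t ⇛[ μL ] s = t ⟹[ μL ] s

TRel : Set₁
TRel = (τ : Type) → Tm τ → Tm τ → Set

𝓔 : TRel → TRel
𝓔 R τ t s = ∀ t′ → t ⟶ t′ → ∃ λ s′ → s ⟹ s′ × R τ t′ s′

𝓥′ : TRel → TRel → TRel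
𝓥′ Q R (var ())
𝓥′ Q R (a ⊞ b) t s =
  (∀ t′ → t —[ ⊞₁ ]→ t′ → ∃ λ s′ → s ⇛[ ⊞₁ ] s′ × R a t′ s′) ×
  (∀ t′ → t —[ ⊞₂ ]→ t′ → ∃ λ s′ → s ⇛[ ⊞₂ ] s′ × R b t′ s′)
𝓥′ Q R (a ⊠ b) t s =
  ∀ t₁ t₂ → t —[ ⊠₁ ]→ t₁ → t —[ ⊠₂ ]→ t₂ →
  ∃ λ s₁ → ∃ λ s₂ → s ⇛[ ⊠₁ ] s₁ × s ⇛[ ⊠₂ ] s₂ × R a t₁ s₁ × R b t₂ s₂
𝓥′ Q R (a ⇒ b) t s =
  ∀ e₁ e₂ → Q a e₁ e₂ → ∀ t′ → t —[ arg e₁ ]→ t′ →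
  ∃ λ s′ → s ⇛[ arg e₂ ] s′ × R b t′ s′
𝓥′ Q R (μ τ) t s =
  ∀ t′ → t —[ μL ]→ t′ → ∃ λ s′ → s ⇛[ μL ] s′ × R (unroll τ) t′ s′

𝓜 : ℕ → TRel
𝓜 zero    τ t s = ⊤
𝓜 (suc n) τ t s = 𝓜 n τ t s × 𝓔 (𝓜 n) τ t s × 𝓥′ (𝓜 n) (𝓜 n) τ t s

𝓜ω : TRel
𝓜ω τ t s = ∀ n → 𝓜 n τ t s

_≲bool_ : ∀ {τ} → Tm τ → Tm τ → Set
_≲bool_ {τ} t s = ∀ (C : Context τ bool) → (C [[ t ]]) ⇓ → (C [[ s ]]) ⇓

-- Contexts preserve 𝓜ⁿ: the closure of 𝓜ⁿ under the term formers lies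
-- inside 𝓜ⁿ, by induction on n and, for fixed n, on the closure.  A
-- context thus relates C[t] and C[s] at every level n.  If C[t] reaches
-- a labelled transition after k silent steps, level k + 1 lets C[s]
-- follow those steps and then match the label, since bool is a sum.

module Submission where

open import Defs
open import Data.Nat using (ℕ; zero; suc; _+_)
open import Data.Product using (∃; _×_; _,_; proj₁)
open import Data.Sum using (inj₁; inj₂)
open import Data.Unit using (tt)
open import Data.Empty using (⊥; ⊥-elim)
open import Data.Maybe using (just)
open import Relation.Binary.PropositionalEquality using (refl)
open import Relation.Binary.Construct.Closure.ReflexiveTransitive
  using (ε; _◅_; _◅◅_; gmap)

infix 4 _⊆_

_⊆_ : TRel → TRel → Set
R ⊆ R′ = ∀ {τ t s} → R τ t s → R′ τ t s

length : ∀ {τ} {u v : Tm τ} → u ⟹ v → ℕ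
length ε        = 0
length (_ ◅ ss) = suc (length ss)

⟹-⇓ : ∀ {τ} {u v : Tm τ} → u ⟹ v → v ⇓ → u ⇓
⟹-⇓ us (σ , l , w , v′ , vs , lt) = σ , l , w , v′ , us ◅◅ vs , lt

data Compat (R : TRel) : TRel where
  root   : R ⊆ Compat R
  S      : ∀ {a b c} → Compat R _ (S {a = a} {b} {c}) S
  K      : ∀ {a b} → Compat R _ (K {a = a} {b}) K
  I      : ∀ {a} → Compat R _ (I {a = a}) I
  S′     : ∀ {a b c} {x y : Tm (a ⇒ b ⇒ c)} → Compat R _ x y → Compat R _ (S′ x) (S′ y)
  S″     : ∀ {a b c} {x y : Tm (a ⇒ b ⇒ c)} {z w : Tm (a ⇒ b)} →
           Compat R _ x y → Compat R _ z w → Compat R _ (S″ x z) (S″ y w)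
  K′     : ∀ {a b} {x y : Tm a} → Compat R _ x y → Compat R (b ⇒ a) (K′ x) (K′ y)
  app    : ∀ {a b} {x y : Tm (a ⇒ b)} {z w : Tm a} →
           Compat R _ x y → Compat R _ z w → Compat R _ (app x z) (app y w)
  inl    : ∀ {a b} {x y : Tm a} → Compat R _ x y → Compat R (a ⊞ b) (inl x) (inl y)
  inr    : ∀ {a b} {x y : Tm b} → Compat R _ x y → Compat R (a ⊞ b) (inr x) (inr y)
  case   : ∀ {a b c} {x y : Tm (a ⊞ b)} {f f′ : Tm (a ⇒ c)} {g g′ : Tm (b ⇒ c)} →
           Compat R _ x y → Compat R _ f f′ → Compat R _ g g′ →
           Compat R _ (case x f g) (case y f′ g′)
  pair   : ∀ {a b} {x y : Tm a} {z w : Tm b} →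
           Compat R _ x y → Compat R _ z w → Compat R _ (pair x z) (pair y w)
  fst    : ∀ {a b} {x y : Tm (a ⊠ b)} → Compat R _ x y → Compat R _ (fst x) (fst y)
  snd    : ∀ {a b} {x y : Tm (a ⊠ b)} → Compat R _ x y → Compat R _ (snd x) (snd y)
  fold   : ∀ {τ} {x y : Tm (unroll τ)} → Compat R _ x y → Compat R (μ τ) (fold x) (fold y)
  unfold : ∀ {τ} {x y : Tm (μ τ)} → Compat R _ x y → Compat R _ (unfold x) (unfold y)

Compat-mono : ∀ {R R′} → R ⊆ R′ → Compat R ⊆ Compat R′
Compat-mono R⊆R′ (root r)       = root (R⊆R′ r)
Compat-mono R⊆R′ S              = S
Compat-mono R⊆R′ K              = K
Compat-mono R⊆R′ I              = I
Compat-mono R⊆R′ (S′ r)         = S′ (Compat-mono R⊆R′ r)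
Compat-mono R⊆R′ (S″ r q)       = S″ (Compat-mono R⊆R′ r) (Compat-mono R⊆R′ q)
Compat-mono R⊆R′ (K′ r)         = K′ (Compat-mono R⊆R′ r)
Compat-mono R⊆R′ (app r q)      = app (Compat-mono R⊆R′ r) (Compat-mono R⊆R′ q)
Compat-mono R⊆R′ (inl r)        = inl (Compat-mono R⊆R′ r)
Compat-mono R⊆R′ (inr r)        = inr (Compat-mono R⊆R′ r)
Compat-mono R⊆R′ (case r q p)   =
  case (Compat-mono R⊆R′ r) (Compat-mono R⊆R′ q) (Compat-mono R⊆R′ p)
Compat-mono R⊆R′ (pair r q)     = pair (Compat-mono R⊆R′ r) (Compat-mono R⊆R′ q)
Compat-mono R⊆R′ (fst r)        = fst (Compat-mono R⊆R′ r)
Compat-mono R⊆R′ (snd r)        = snd (Compat-mono R⊆R′ r)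
Compat-mono R⊆R′ (fold r)       = fold (Compat-mono R⊆R′ r)
Compat-mono R⊆R′ (unfold r)     = unfold (Compat-mono R⊆R′ r)

plugT-Compat : ∀ {R τ σ} (C : Term (just τ) σ) {t s : Tm τ} →
               R τ t s → Compat R σ (plugT C t) (plugT C s)
plugT-Compat (hole refl)  r = root r
plugT-Compat S            r = S
plugT-Compat K            r = K
plugT-Compat I            r = I
plugT-Compat (S′ C)       r = S′ (plugT-Compat C r)
plugT-Compat (S″ C D)     r = S″ (plugT-Compat C r) (plugT-Compat D r)
plugT-Compat (K′ C)       r = K′ (plugT-Compat C r)
plugT-Compat (app C D)    r = app (plugT-Compat C r) (plugT-Compat D r)
plugT-Compat (inl C)      r = inl (plugT-Compat C r)
plugT-Compat (inr C)      r = inr (plugT-Compat C r)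
plugT-Compat (case C D E) r = case (plugT-Compat C r) (plugT-Compat D r) (plugT-Compat E r)
plugT-Compat (pair C D)   r = pair (plugT-Compat C r) (plugT-Compat D r)
plugT-Compat (fst C)      r = fst (plugT-Compat C r)
plugT-Compat (snd C)      r = snd (plugT-Compat C r)
plugT-Compat (fold C)     r = fold (plugT-Compat C r)
plugT-Compat (unfold C)   r = unfold (plugT-Compat C r)

NoLabelledStep : ∀ {τ} → Tm τ → Set
NoLabelledStep {τ} u = ∀ {σ} {l : Lab τ σ} {w} → u —[ l ]→ w → ⊥

𝓥′-NoLabelledStep : ∀ {Q R} τ {u v : Tm τ} → NoLabelledStep u → 𝓥′ Q R τ u v
𝓥′-NoLabelledStep (var ())
𝓥′-NoLabelledStep (a ⊞ b) nl = (λ _ lt → ⊥-elim (nl lt)) , (λ _ lt → ⊥-elim (nl lt))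
𝓥′-NoLabelledStep (a ⊠ b) nl = λ _ _ lt _ → ⊥-elim (nl lt)
𝓥′-NoLabelledStep (a ⇒ b) nl = λ _ _ _ _ lt → ⊥-elim (nl lt)
𝓥′-NoLabelledStep (μ τ)   nl = λ _ lt → ⊥-elim (nl lt)

module Compat-𝓜-step (n : ℕ) (compat : Compat (𝓜 n) ⊆ 𝓜 n) where

  lower : Compat (𝓜 (suc n)) ⊆ Compat (𝓜 n)
  lower = Compat-mono proj₁

  𝓥′-Compat : ∀ {τ u v} → Compat (𝓜 (suc n)) τ u v → 𝓥′ (𝓜 n) (𝓜 n) τ u v
  𝓥′-Compat (root (_ , _ , V)) = V
  𝓥′-Compat S = λ { _ _ q _ S-e → _ , (_ , ε , inj₁ S-e) , compat (S′ (root q)) }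
  𝓥′-Compat K = λ { _ _ q _ K-e → _ , (_ , ε , inj₁ K-e) , compat (K′ (root q)) }
  𝓥′-Compat I = λ { _ _ q _ I-e → _ , (_ , ε , inj₁ I-e) , q }
  𝓥′-Compat (S′ r) =
    λ { _ _ q _ S′-e → _ , (_ , ε , inj₁ S′-e) , compat (S″ (lower r) (root q)) }
  𝓥′-Compat (S″ r p) =
    λ { _ _ q _ S″-e → _ , (_ , ε , inj₁ S″-e) ,
          compat (app (app (lower r) (root q)) (app (lower p) (root q))) }
  𝓥′-Compat (K′ r) = λ { _ _ _ _ K′-e → _ , (_ , ε , inj₁ K′-e) , compat (lower r) }
  𝓥′-Compat (inl r) = (λ { _ inl-l → _ , (_ , ε , inl-l) , compat (lower r) }) , λ _ ()
  𝓥′-Compat (inr r) = (λ _ ()) , λ { _ inr-l → _ , (_ , ε , inr-l) , compat (lower r) }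
  𝓥′-Compat (pair r p) =
    λ { _ _ pair₁ pair₂ → _ , _ , (_ , ε , pair₁) , (_ , ε , pair₂) ,
          compat (lower r) , compat (lower p) }
  𝓥′-Compat (fold r) = λ { _ fold-l → _ , (_ , ε , fold-l) , compat (lower r) }
  𝓥′-Compat (app {b = b} _ _)  = 𝓥′-NoLabelledStep b λ ()
  𝓥′-Compat (case {c = c} _ _ _) = 𝓥′-NoLabelledStep c λ ()
  𝓥′-Compat (fst {a = a} _)    = 𝓥′-NoLabelledStep a λ ()
  𝓥′-Compat (snd {b = b} _)    = 𝓥′-NoLabelledStep b λ ()
  𝓥′-Compat (unfold {τ = τ} _) = 𝓥′-NoLabelledStep (unroll τ) λ ()

  mutual
    Compat-𝓜-suc : Compat (𝓜 (suc n)) ⊆ 𝓜 (suc n)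
    Compat-𝓜-suc r = compat (lower r) , 𝓔-Compat r , 𝓥′-Compat r

    𝓔-Compat : ∀ {τ u v} → Compat (𝓜 (suc n)) τ u v → 𝓔 (𝓜 n) τ u v
    𝓔-Compat (root (_ , E , _)) = E
    𝓔-Compat (app r p) _ (app-l st) with Compat-𝓜-suc r
    ... | _ , E , _ with E _ st
    ... | _ , ys , m = _ , gmap _ app-l ys , compat (app (root m) (lower p))
    𝓔-Compat (app r p) _ (app-β lt) with Compat-𝓜-suc r | Compat-𝓜-suc p
    ... | _ , _ , V | q , _ with V _ _ q _ lt
    ... | _ , (_ , ys , inj₁ lt′) , m = _ , gmap _ app-l ys ◅◅ (app-β lt′ ◅ ε) , m
    ... | _ , (_ , ys , inj₂ refl) , m = _ , gmap _ app-l ys , m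
    𝓔-Compat (case r f g) _ (case-l st) with Compat-𝓜-suc r
    ... | _ , E , _ with E _ st
    ... | _ , ys , m = _ , gmap _ case-l ys , compat (case (root m) (lower f) (lower g))
    𝓔-Compat (case r f g) _ (case-β₁ lt) with Compat-𝓜-suc r
    ... | _ , _ , V₁ , _ with V₁ _ lt
    ... | _ , (_ , ys , lt′) , m =
      _ , gmap _ case-l ys ◅◅ (case-β₁ lt′ ◅ ε) , compat (app (lower f) (root m))
    𝓔-Compat (case r f g) _ (case-β₂ lt) with Compat-𝓜-suc r
    ... | _ , _ , _ , V₂ with V₂ _ lt
    ... | _ , (_ , ys , lt′) , m =
      _ , gmap _ case-l ys ◅◅ (case-β₂ lt′ ◅ ε) , compat (app (lower g) (root m))
    𝓔-Compat (fst r) _ (fst-l st) with Compat-𝓜-suc r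
    ... | _ , E , _ with E _ st
    ... | _ , ys , m = _ , gmap _ fst-l ys , compat (fst (root m))
    𝓔-Compat (fst r) _ (fst-β pair₁) with Compat-𝓜-suc r
    ... | _ , _ , V with V _ _ pair₁ pair₂
    ... | _ , _ , (_ , ys , lt′) , _ , m , _ = _ , gmap _ fst-l ys ◅◅ (fst-β lt′ ◅ ε) , m
    𝓔-Compat (snd r) _ (snd-l st) with Compat-𝓜-suc r
    ... | _ , E , _ with E _ st
    ... | _ , ys , m = _ , gmap _ snd-l ys , compat (snd (root m))
    𝓔-Compat (snd r) _ (snd-β pair₂) with Compat-𝓜-suc r
    ... | _ , _ , V with V _ _ pair₁ pair₂
    ... | _ , _ , _ , (_ , ys , lt′) , _ , m = _ , gmap _ snd-l ys ◅◅ (snd-β lt′ ◅ ε) , m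
    𝓔-Compat (unfold r) _ (unfold-l st) with Compat-𝓜-suc r
    ... | _ , E , _ with E _ st
    ... | _ , ys , m = _ , gmap _ unfold-l ys , compat (unfold (root m))
    𝓔-Compat (unfold r) _ (unfold-β lt) with Compat-𝓜-suc r
    ... | _ , _ , V with V _ lt
    ... | _ , (_ , ys , lt′) , m = _ , gmap _ unfold-l ys ◅◅ (unfold-β lt′ ◅ ε) , m
    𝓔-Compat S _ ()
    𝓔-Compat K _ ()
    𝓔-Compat I _ ()
    𝓔-Compat (S′ _) _ ()
    𝓔-Compat (S″ _ _) _ ()
    𝓔-Compat (K′ _) _ ()
    𝓔-Compat (inl _) _ ()
    𝓔-Compat (inr _) _ ()
    𝓔-Compat (pair _ _) _ ()
    𝓔-Compat (fold _) _ ()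

Compat-𝓜 : ∀ n → Compat (𝓜 n) ⊆ 𝓜 n
Compat-𝓜 zero    _ = tt
Compat-𝓜 (suc n) = Compat-𝓜-step.Compat-𝓜-suc n (Compat-𝓜 n)

𝓜-simulates-⟹ : ∀ k {τ} {u u′ v : Tm τ} (us : u ⟹ u′) →
                 𝓜 (length us + k) τ u v → ∃ λ v′ → v ⟹ v′ × 𝓜 k τ u′ v′
𝓜-simulates-⟹ k ε m = _ , ε , m
𝓜-simulates-⟹ k (st ◅ us) (_ , E , _) with E _ st
... | _ , vs , m with 𝓜-simulates-⟹ k us m
... | v′ , vs′ , m′ = v′ , vs ◅◅ vs′ , m′

𝓜₁-⊞-⇓ : ∀ {a b σ} {l : Lab (a ⊞ b) σ} {u v w} → u —[ l ]→ w → 𝓜 1 _ u v → v ⇓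
𝓜₁-⊞-⇓ inl-l (_ , _ , V₁ , _) with V₁ _ inl-l
... | v′ , vs , _ = _ , ⊞₁ , v′ , vs
𝓜₁-⊞-⇓ inr-l (_ , _ , _ , V₂) with V₂ _ inr-l
... | v′ , vs , _ = _ , ⊞₂ , v′ , vs

corollary3p12 : (τ : Type) (t s : Tm τ) → 𝓜ω τ t s → t ≲bool s
corollary3p12 τ t s m (ctx C _) (_ , _ , _ , _ , us , lt)
  with 𝓜-simulates-⟹ 1 us (Compat-𝓜 _ (plugT-Compat C (m (length us + 1))))
... | _ , vs , m′ = ⟹-⇓ vs (𝓜₁-⊞-⇓ lt m′)
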